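{- Let $G$ be a cubic graph on $n \ge 8$ vertices that has a self-identifying code. Then $\mathrm{SIC}(G) = n$ if and only if every vertex of $G$ is adjacent to a triangle not containing itself.
   Context: All graphs are finite, simple, undirected and connected; a cubic graph is 3-regular. $N[v] = N(v) \cup \{v\}$; $N_S[v] = N[v] \cap S$. A set $S \subseteq V(G)$ is a self-identifying code (SIC) if for every $x \in V(G)$, $N_S[x] \neq \varnothing$ and $\bigcap_{v \in N_S[x]} N[v] = \{x\}$; $\mathrm{SIC}(G)$ is the minimum cardinality of an SIC. A vertex $v$ is adjacent to a triangle not containing itself if there are vertices $a,b,c$ forming a triangle with $v \notin \{a,b,c\}$ and $va \in E(G)$. -}

module Defs where

open import Data.Nat using (ℕ; zero; suc; _≤_)
open import Data.Bool using (Bool; true; false; T)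
open import Data.Fin using (Fin)
open import Data.Fin.Subset using (Subset; _∈_; ∣_∣)
open import Data.Vec using (tabulate)
open import Data.Product using (Σ; ∃; ∃-syntax; _×_; _,_)
open import Data.Sum using (_⊎_)
open import Relation.Binary.PropositionalEquality using (_≡_)
open import Relation.Nullary using (¬_)

record Graph (n : ℕ) : Set where
  field
    adj   : Fin n → Fin n → Bool
    sym   : ∀ u v → adj u v ≡ adj v u
    irrefl : ∀ v → adj v v ≡ false

module _ {n : ℕ} (G : Graph n) where
  open Graph G

  Adj : Fin n → Fin n → Set
  Adj u v = T (adj u v)

  nbhd : Fin n → Subset n
  nbhd v = tabulate (adj v)

  InClosedNbhd : Fin n → Fin n → Set
  InClosedNbhd u v = u ≡ v ⊎ Adj v u

  data Walk : Fin n → Fin n → Set where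
    here : ∀ {v} → Walk v v
    step : ∀ {u v w} → Adj u v → Walk v w → Walk u w

  Connected : Set
  Connected = ∀ u v → Walk u v

  Cubic : Set
  Cubic = ∀ v → ∣ nbhd v ∣ ≡ 3

  -- S is a self-identifying code:
  --  for every x, N_S[x] ≠ ∅, and ⋂_{v ∈ N_S[x]} N[v] = {x}.
  -- (x always lies in that intersection, so equality with {x} means every
  --  y lying in all N[v], v ∈ N_S[x], equals x.)
  IsSIC : Subset n → Set
  IsSIC S = ∀ x →
      (∃[ v ] (v ∈ S × InClosedNbhd v x))
    × (∀ y → (∀ v → v ∈ S → InClosedNbhd v x → InClosedNbhd y v) → y ≡ x)

  HasSIC : Set
  HasSIC = ∃[ S ] IsSIC S

  SICNumberIs : ℕ → Set
  SICNumberIs k = (∃[ S ] (IsSIC S × ∣ S ∣ ≡ k)) × (∀ S → IsSIC S → k ≤ ∣ S ∣)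

  AdjToTriangle : Fin n → Set
  AdjToTriangle v = ∃[ a ] ∃[ b ] ∃[ c ]
      (Adj a b × Adj b c × Adj a c
     × ¬ (v ≡ a) × ¬ (v ≡ b) × ¬ (v ≡ c) × Adj v a)

-- If every vertex hangs off a triangle, every SIC S contains every vertex: were v ∉ S attached
-- at a to the triangle abc, each vertex of N_S[a] ⊆ {a, b, c} would have b in its closed
-- neighbourhood, so S could not separate a from b.  Conversely, if SIC(G) = n then no V − u is an
-- SIC, which forces every vertex u that does not hang off a triangle to have a false twin y.
-- Since V itself separates vertices, no edge lies on two triangles.  For a vertex v off all
-- triangles, with twin y, this rules out triangles around N(v) = {a, b, c}, so a, b, c have
-- false twins as well; these lie in N(v), hence a, b, c share their third neighbour w.  Then
-- {v, y, w} ∪ {a, b, c} is a K₃,₃ component, and connectivity gives n ≤ 6 < 8.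

module Submission where

open import Defs
open import Data.Nat using (ℕ; _≤_)
open import Data.Fin using (Fin)
open import Function.Bundles using (_⇔_)

open import Data.Bool using (T)
open import Data.Bool.Properties using (T-≡)
open import Data.Empty using (⊥; ⊥-elim)
open import Data.Fin using (_≟_)
open import Data.Fin.Properties using (any?; all?)
open import Data.Fin.Subset using (Subset; _∈_; _⊆_; ∣_∣; ⊤; ⁅_⁆; _∪_; _-_; ⋃; inside; outside)
open import Data.Fin.Subset.Properties
  using (∈⊤; ∣⊤∣≡n; ∣⊥∣≡0; ∣⁅x⁆∣≡1; x∈⁅x⁆; x∈p∪q⁺; p⊆q⇒∣p∣≤∣q∣; x∈p∧x≢y⇒x∈p-y; x∈p⇒∣p-x∣<∣p∣; _∈?_)
open import Data.List using (List; []; _∷_; length; map)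
open import Data.List.Membership.Propositional using () renaming (_∈_ to _∈ₗ_)
open import Data.List.Relation.Unary.All using (All; []; _∷_)
open import Data.List.Relation.Unary.Any using (here; there)
open import Data.List.Relation.Unary.Unique.Propositional using (Unique; []; _∷_)
open import Data.Nat using (_+_; _<_; z≤n; s≤s)
open import Data.Nat.Properties using (≤-trans; ≤-reflexive; +-suc; +-monoʳ-≤; n≤1+n; <⇒≱)
open import Data.Product using (∃-syntax; _×_; _,_; proj₁; proj₂)
open import Data.Sum using (_⊎_; inj₁; inj₂)
open import Data.Vec using (_∷_; [])
open import Data.Vec.Properties using (lookup∘tabulate; lookup⇒[]=; []=⇒lookup)
open import Function using (_∘_)
open import Function.Bundles using (mk⇔; Equivalence)
open import Relation.Binary.PropositionalEquality using (_≡_; _≢_; refl; sym; trans; cong; subst; ≢-sym)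
open import Relation.Nullary using (¬_; Dec; yes; no)
open import Relation.Nullary.Decidable using (_×-dec_; _⊎-dec_; _→-dec_; ¬?; T?)

∣p∪q∣≤∣p∣+∣q∣ : ∀ {n} (p q : Subset n) → ∣ p ∪ q ∣ ≤ ∣ p ∣ + ∣ q ∣
∣p∪q∣≤∣p∣+∣q∣ []            []            = z≤n
∣p∪q∣≤∣p∣+∣q∣ (outside ∷ p) (outside ∷ q) = ∣p∪q∣≤∣p∣+∣q∣ p q
∣p∪q∣≤∣p∣+∣q∣ (outside ∷ p) (inside ∷ q)  =
  ≤-trans (s≤s (∣p∪q∣≤∣p∣+∣q∣ p q)) (≤-reflexive (sym (+-suc ∣ p ∣ ∣ q ∣)))
∣p∪q∣≤∣p∣+∣q∣ (inside ∷ p)  (outside ∷ q) = s≤s (∣p∪q∣≤∣p∣+∣q∣ p q)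
∣p∪q∣≤∣p∣+∣q∣ (inside ∷ p)  (inside ∷ q)  =
  s≤s (≤-trans (∣p∪q∣≤∣p∣+∣q∣ p q) (+-monoʳ-≤ ∣ p ∣ (n≤1+n ∣ q ∣)))

∣⋃⁅xs⁆∣≤length : ∀ {n} (xs : List (Fin n)) → ∣ ⋃ (map ⁅_⁆ xs) ∣ ≤ length xs
∣⋃⁅xs⁆∣≤length {n} []       = ≤-reflexive (∣⊥∣≡0 n)
∣⋃⁅xs⁆∣≤length     (x ∷ xs) = ≤-trans (∣p∪q∣≤∣p∣+∣q∣ ⁅ x ⁆ (⋃ (map ⁅_⁆ xs)))
  (≤-trans (≤-reflexive (cong (_+ _) (∣⁅x⁆∣≡1 x))) (s≤s (∣⋃⁅xs⁆∣≤length xs)))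

∈⇒∈⋃⁅xs⁆ : ∀ {n} {x : Fin n} {xs} → x ∈ₗ xs → x ∈ ⋃ (map ⁅_⁆ xs)
∈⇒∈⋃⁅xs⁆ {x = x} (here refl) = x∈p∪q⁺ (inj₁ (x∈⁅x⁆ x))
∈⇒∈⋃⁅xs⁆         (there x∈xs) = x∈p∪q⁺ (inj₂ (∈⇒∈⋃⁅xs⁆ x∈xs))

∣p∣≤length : ∀ {n} {p : Subset n} (xs : List (Fin n)) → (∀ {x} → x ∈ p → x ∈ₗ xs) → ∣ p ∣ ≤ length xs
∣p∣≤length xs p⊆xs = ≤-trans (p⊆q⇒∣p∣≤∣q∣ (∈⇒∈⋃⁅xs⁆ ∘ p⊆xs)) (∣⋃⁅xs⁆∣≤length xs)

length≤∣p∣ : ∀ {n} {p : Subset n} {xs : List (Fin n)} → Unique xs → All (_∈ p) xs → length xs ≤ ∣ p ∣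
length≤∣p∣ []                     []            = z≤n
length≤∣p∣ {p = p} {x ∷ xs} (x∉xs ∷ u) (x∈p ∷ xs⊆p) =
  ≤-trans (s≤s (length≤∣p∣ u (removing x∉xs xs⊆p))) (x∈p⇒∣p-x∣<∣p∣ x∈p)
  where
  removing : ∀ {ys} → All (x ≢_) ys → All (_∈ p) ys → All (_∈ p - x) ys
  removing []            []            = []
  removing (x≢y ∷ x≢ys) (y∈p ∷ ys⊆p) = x∈p∧x≢y⇒x∈p-y y∈p (≢-sym x≢y) ∷ removing x≢ys ys⊆p

module _ {n : ℕ} (G : Graph n) where

  infix 4 _~_
  _~_ : Fin n → Fin n → Set
  _~_ = Adj G

  ~-sym : ∀ {u v} → u ~ v → v ~ u
  ~-sym {u} {v} = subst T (Graph.sym G u v)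

  ~-irrefl : ∀ {v} → ¬ v ~ v
  ~-irrefl {v} = subst T (Graph.irrefl G v)

  ~⇒≢ : ∀ {u v} → u ~ v → u ≢ v
  ~⇒≢ v~v refl = ~-irrefl v~v

  _~?_ : ∀ u v → Dec (u ~ v)
  u ~? v = T? (Graph.adj G u v)

  ~⇒∈nbhd : ∀ {x z} → x ~ z → z ∈ nbhd G x
  ~⇒∈nbhd {x} {z} x~z = lookup⇒[]= z (nbhd G x)
    (trans (lookup∘tabulate (Graph.adj G x) z) (Equivalence.to T-≡ x~z))

  ∈nbhd⇒~ : ∀ {x z} → z ∈ nbhd G x → x ~ z
  ∈nbhd⇒~ {x} {z} z∈N = Equivalence.from T-≡
    (trans (sym (lookup∘tabulate (Graph.adj G x) z)) ([]=⇒lookup z∈N))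

  infix 4 _∈N[_]
  _∈N[_] : Fin n → Fin n → Set
  _∈N[_] = InClosedNbhd G

  _∈N[_]? : ∀ u v → Dec (u ∈N[ v ])
  u ∈N[ v ]? = (u ≟ v) ⊎-dec (v ~? u)

  IsSIC-mono : ∀ {S T} → S ⊆ T → IsSIC G S → IsSIC G T
  IsSIC-mono {S} {T} S⊆T S-SIC x = dominated (proj₁ (S-SIC x)) , λ y h → proj₂ (S-SIC x) y (λ v → h v ∘ S⊆T)
    where
    dominated : ∃[ v ] (v ∈ S × v ∈N[ x ]) → ∃[ v ] (v ∈ T × v ∈N[ x ])
    dominated (v , v∈S , v∈N[x]) = v , S⊆T v∈S , v∈N[x]

  AdjToTriangle? : ∀ v → Dec (AdjToTriangle G v)
  AdjToTriangle? v = any? λ a → any? λ b → any? λ c →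
    (a ~? b) ×-dec (b ~? c) ×-dec (a ~? c) ×-dec ¬? (v ≟ a) ×-dec ¬? (v ≟ b) ×-dec ¬? (v ≟ c) ×-dec (v ~? a)

  -- Only N(u) ⊆ N(y) is required; in a cubic graph this already forces N(u) = N(y).
  FalseTwin : Fin n → Fin n → Set
  FalseTwin u y = y ≢ u × ¬ u ~ y × (∀ w → u ~ w → y ~ w)

  HasFalseTwin : Fin n → Set
  HasFalseTwin u = ∃[ y ] FalseTwin u y

  HasFalseTwin? : ∀ u → Dec (HasFalseTwin u)
  HasFalseTwin? u = any? λ y → ¬? (y ≟ u) ×-dec ¬? (u ~? y) ×-dec all? (λ w → (u ~? w) →-dec (y ~? w))

  reachable-in-closed : ∀ {L u w} → Walk G u w → u ∈ₗ L → (∀ {x z} → x ∈ₗ L → x ~ z → z ∈ₗ L) → w ∈ₗ L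
  reachable-in-closed here           u∈L closed = u∈L
  reachable-in-closed (step u~x walk) u∈L closed = reachable-in-closed walk (closed u∈L u~x) closed

  order≤length-of-closed : Connected G → ∀ {L u} → u ∈ₗ L → (∀ {x z} → x ∈ₗ L → x ~ z → z ∈ₗ L) → n ≤ length L
  order≤length-of-closed connected {L} {u} u∈L closed = subst (_≤ length L) (∣⊤∣≡n n)
    (∣p∣≤length {p = ⊤} L (λ {w} _ → reachable-in-closed (connected u w) u∈L closed))

  module CubicGraph (cubic : Cubic G) where

    neighbour-avoiding : ∀ x p q → ∃[ z ] (x ~ z × z ≢ p × z ≢ q)
    neighbour-avoiding x p q with any? (λ z → (x ~? z) ×-dec ¬? (z ≟ p) ×-dec ¬? (z ≟ q))
    ... | yes found = found
    ... | no none = ⊥-elim (3≰2 (subst (_≤ 2) (cubic x) (∣p∣≤length (p ∷ q ∷ []) Nx⊆pq)))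
      where
      3≰2 : ¬ 3 ≤ 2
      3≰2 (s≤s (s≤s ()))
      Nx⊆pq : ∀ {z} → z ∈ nbhd G x → z ∈ₗ p ∷ q ∷ []
      Nx⊆pq {z} z∈N with z ≟ p | z ≟ q
      ... | yes z≡p | _       = here z≡p
      ... | no _    | yes z≡q = there (here z≡q)
      ... | no z≢p  | no z≢q  = ⊥-elim (none (z , ∈nbhd⇒~ z∈N , z≢p , z≢q))

    three-neighbours : ∀ x → ∃[ a ] ∃[ b ] ∃[ c ] (x ~ a × x ~ b × x ~ c × a ≢ b × a ≢ c × b ≢ c)
    three-neighbours x with neighbour-avoiding x x x
    ... | a , x~a , _ with neighbour-avoiding x a a
    ... | b , x~b , b≢a , _ with neighbour-avoiding x a b
    ... | c , x~c , c≢a , c≢b = a , b , c , x~a , x~b , x~c , ≢-sym b≢a , ≢-sym c≢a , ≢-sym c≢b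

    neighbours-among : ∀ x p q r → x ~ p → x ~ q → x ~ r → p ≢ q → p ≢ r → q ≢ r →
                       ∀ w → x ~ w → w ≡ p ⊎ w ≡ q ⊎ w ≡ r
    neighbours-among x p q r x~p x~q x~r p≢q p≢r q≢r w x~w with w ≟ p | w ≟ q | w ≟ r
    ... | yes w≡p | _       | _       = inj₁ w≡p
    ... | no _    | yes w≡q | _       = inj₂ (inj₁ w≡q)
    ... | no _    | no _    | yes w≡r = inj₂ (inj₂ w≡r)
    ... | no w≢p  | no w≢q  | no w≢r  = ⊥-elim (4≰3 (subst (4 ≤_) (cubic x) (length≤∣p∣ distinct neighbours)))
      where
      4≰3 : ¬ 4 ≤ 3
      4≰3 (s≤s (s≤s (s≤s ())))
      distinct : Unique (p ∷ q ∷ r ∷ w ∷ [])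
      distinct = (p≢q ∷ p≢r ∷ ≢-sym w≢p ∷ []) ∷ (q≢r ∷ ≢-sym w≢q ∷ []) ∷ (≢-sym w≢r ∷ []) ∷ [] ∷ []
      neighbours : All (_∈ nbhd G x) (p ∷ q ∷ r ∷ w ∷ [])
      neighbours = ~⇒∈nbhd x~p ∷ ~⇒∈nbhd x~q ∷ ~⇒∈nbhd x~r ∷ ~⇒∈nbhd x~w ∷ []

    adjToTriangle⇒∈SIC : ∀ {S} v → IsSIC G S → AdjToTriangle G v → v ∈ S
    adjToTriangle⇒∈SIC {S} v S-SIC (a , b , c , a~b , b~c , a~c , _ , v≢b , v≢c , v~a) with v ∈? S
    ... | yes v∈S = v∈S
    ... | no v∉S = ⊥-elim (~⇒≢ a~b (sym (proj₂ (S-SIC a) b b∈N[N_S[a]])))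
      where
      b∈N[N_S[a]] : ∀ w → w ∈ S → w ∈N[ a ] → b ∈N[ w ]
      b∈N[N_S[a]] w _   (inj₁ refl) = inj₂ a~b
      b∈N[N_S[a]] w w∈S (inj₂ a~w)
        with neighbours-among a b c v a~b a~c (~-sym v~a) (~⇒≢ b~c) (≢-sym v≢b) (≢-sym v≢c) w a~w
      ... | inj₁ refl        = inj₁ refl
      ... | inj₂ (inj₁ refl) = inj₂ (~-sym b~c)
      ... | inj₂ (inj₂ refl) = ⊥-elim (v∉S w∈S)

    allAdjToTriangle⇒SICNumber≡n : IsSIC G ⊤ → (∀ v → AdjToTriangle G v) → SICNumberIs G n
    allAdjToTriangle⇒SICNumber≡n V-SIC allTri = (⊤ , V-SIC , ∣⊤∣≡n n) , λ S S-SIC →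
      subst (_≤ ∣ S ∣) (∣⊤∣≡n n) (p⊆q⇒∣p∣≤∣q∣ {p = ⊤} λ {v} _ → adjToTriangle⇒∈SIC v S-SIC (allTri v))

    module _ (V-SIC : IsSIC G ⊤) where

      ⊤-separates : ∀ q r → (∀ w → w ∈N[ q ] → r ∈N[ w ]) → r ≡ q
      ⊤-separates q r r∈N[N[q]] = proj₂ (V-SIC q) r (λ w _ → r∈N[N[q]] w)

      no-diamond : ∀ q r p s → q ~ r → q ~ p → r ~ p → q ~ s → r ~ s → p ≢ s → ⊥
      no-diamond q r p s q~r q~p r~p q~s r~s p≢s = ~⇒≢ q~r (sym (⊤-separates q r r∈N[N[q]]))
        where
        r∈N[N[q]] : ∀ w → w ∈N[ q ] → r ∈N[ w ]
        r∈N[N[q]] w (inj₁ refl) = inj₂ q~r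
        r∈N[N[q]] w (inj₂ q~w) with neighbours-among q r p s q~r q~p q~s (~⇒≢ r~p) (~⇒≢ r~s) p≢s w q~w
        ... | inj₁ refl        = inj₁ refl
        ... | inj₂ (inj₁ refl) = inj₂ (~-sym r~p)
        ... | inj₂ (inj₂ refl) = inj₂ (~-sym r~s)

      pendant-edge-of-triangle-in-no-triangle : ∀ q t₁ t₂ p r → q ~ t₁ → q ~ t₂ → t₁ ~ t₂ →
        q ~ p → p ≢ t₁ → p ≢ t₂ → q ~ r → ¬ p ~ r
      pendant-edge-of-triangle-in-no-triangle q t₁ t₂ p r q~t₁ q~t₂ t₁~t₂ q~p p≢t₁ p≢t₂ q~r p~r
        with neighbours-among q p t₁ t₂ q~p q~t₁ q~t₂ p≢t₁ p≢t₂ (~⇒≢ t₁~t₂) r q~r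
      ... | inj₁ refl        = ~-irrefl p~r
      ... | inj₂ (inj₁ refl) = no-diamond q t₁ p t₂ q~t₁ q~p (~-sym p~r) q~t₂ t₁~t₂ p≢t₂
      ... | inj₂ (inj₂ refl) = no-diamond q t₂ p t₁ q~t₂ q~p (~-sym p~r) q~t₁ (~-sym t₁~t₂) p≢t₁

      module _ (u : Fin n) (¬tri : ¬ AdjToTriangle G u) (¬twin : ¬ HasFalseTwin u) where

        ∈⊤-u : ∀ {x} → x ≢ u → x ∈ ⊤ - u
        ∈⊤-u x≢u = x∈p∧x≢y⇒x∈p-y ∈⊤ x≢u

        -- A vertex y that ⊤ - u fails to separate from x is not separated from x by u either:
        -- otherwise y would be a false twin of u, or u would hang off the triangle x y z.
        u-does-not-separate : ∀ x y → (∀ w → w ∈ ⊤ - u → w ∈N[ x ] → y ∈N[ w ]) → u ∈N[ x ] → y ∈N[ u ]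
        u-does-not-separate x y y∈N[N_S[x]] u∈N[x] with y ∈N[ u ]?
        ... | yes y∈N[u] = y∈N[u]
        ... | no y∉N[u] = ⊥-elim (absurd u∈N[x])
          where
          absurd : u ∈N[ x ] → ⊥
          absurd (inj₁ refl) = ¬twin (y , y∉N[u] ∘ inj₁ , y∉N[u] ∘ inj₂ , Nu⊆Ny)
            where
            Nu⊆Ny : ∀ w → u ~ w → y ~ w
            Nu⊆Ny w u~w with y∈N[N_S[x]] w (∈⊤-u (≢-sym (~⇒≢ u~w))) (inj₂ u~w)
            ... | inj₁ refl = ⊥-elim (y∉N[u] (inj₂ u~w))
            ... | inj₂ w~y  = ~-sym w~y
          absurd (inj₂ x~u) with y∈N[N_S[x]] x (∈⊤-u (~⇒≢ x~u)) (inj₁ refl)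
          ... | inj₁ refl = y∉N[u] (inj₂ (~-sym x~u))
          ... | inj₂ x~y with neighbour-avoiding x u y
          ... | z , x~z , z≢u , z≢y with y∈N[N_S[x]] z (∈⊤-u z≢u) (inj₂ x~z)
          ... | inj₁ refl = z≢y refl
          ... | inj₂ z~y = ¬tri (x , y , z , x~y , ~-sym z~y , x~z , ≢-sym (~⇒≢ x~u) ,
                                 y∉N[u] ∘ inj₁ ∘ sym , ≢-sym z≢u , ~-sym x~u)

        ⊤-u-isSIC : IsSIC G (⊤ - u)
        ⊤-u-isSIC x = dominated , λ y y∈N[N_S[x]] → proj₂ (V-SIC x) y (λ w _ → y∈N[w] y y∈N[N_S[x]] w)
          where
          dominated : ∃[ w ] (w ∈ ⊤ - u × w ∈N[ x ])
          dominated with x ≟ u | neighbour-avoiding x u u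
          ... | no x≢u  | _ = x , ∈⊤-u x≢u , inj₁ refl
          ... | yes _   | z , x~z , z≢u , _ = z , ∈⊤-u z≢u , inj₂ x~z
          y∈N[w] : ∀ y → (∀ w → w ∈ ⊤ - u → w ∈N[ x ] → y ∈N[ w ]) → ∀ w → w ∈N[ x ] → y ∈N[ w ]
          y∈N[w] y y∈N[N_S[x]] w w∈N[x] with w ≟ u
          ... | no w≢u  = y∈N[N_S[x]] w (∈⊤-u w≢u) w∈N[x]
          ... | yes refl = u-does-not-separate x y y∈N[N_S[x]] w∈N[x]

      ¬adjToTriangle⇒hasFalseTwin : SICNumberIs G n → ∀ u → ¬ AdjToTriangle G u → HasFalseTwin u
      ¬adjToTriangle⇒hasFalseTwin (_ , minimal) u ¬tri with HasFalseTwin? u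
      ... | yes twin = twin
      ... | no ¬twin = ⊥-elim (<⇒≱ (subst (∣ ⊤ - u ∣ <_) (∣⊤∣≡n n) (x∈p⇒∣p-x∣<∣p∣ {x = u} {p = ⊤} ∈⊤))
                                    (minimal (⊤ - u) (⊤-u-isSIC u ¬tri ¬twin)))

      module FalseTwinNeighbourhood
          (¬tri⇒twin : ∀ u → ¬ AdjToTriangle G u → HasFalseTwin u)
          (v : Fin n) (¬tri-v : ¬ AdjToTriangle G v)
          (y : Fin n) (y≢v : y ≢ v) (v≁y : ¬ v ~ y) (Nv⊆Ny : ∀ w → v ~ w → y ~ w)
          (a b c : Fin n) (v~a : v ~ a) (v~b : v ~ b) (v~c : v ~ c) (a≢b : a ≢ b) (a≢c : a ≢ c) (b≢c : b ≢ c)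
          where

        neighbours-of-v : ∀ w → v ~ w → w ≡ a ⊎ w ≡ b ⊎ w ≡ c
        neighbours-of-v = neighbours-among v a b c v~a v~b v~c a≢b a≢c b≢c

        neighbours-of-y : ∀ w → y ~ w → w ≡ a ⊎ w ≡ b ⊎ w ≡ c
        neighbours-of-y = neighbours-among y a b c (Nv⊆Ny a v~a) (Nv⊆Ny b v~b) (Nv⊆Ny c v~c) a≢b a≢c b≢c

        Ny⊆Nv : ∀ w → y ~ w → v ~ w
        Ny⊆Nv w y~w with neighbours-of-y w y~w
        ... | inj₁ refl        = v~a
        ... | inj₂ (inj₁ refl) = v~b
        ... | inj₂ (inj₂ refl) = v~c

        Nv-independent : ∀ p q → v ~ p → v ~ q → ¬ p ~ q
        Nv-independent p q v~p v~q p~q = ¬tri-v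
          (p , q , y , p~q , ~-sym (Nv⊆Ny q v~q) , ~-sym (Nv⊆Ny p v~p) , ~⇒≢ v~p , ~⇒≢ v~q , ≢-sym y≢v , v~p)

        Ny-independent : ∀ p q → y ~ p → y ~ q → ¬ p ~ q
        Ny-independent p q y~p y~q = Nv-independent p q (Ny⊆Nv p y~p) (Ny⊆Nv q y~q)

        v,y-independent : ∀ p q → p ≡ v ⊎ p ≡ y → q ≡ v ⊎ q ≡ y → ¬ p ~ q
        v,y-independent p q (inj₁ refl) (inj₁ refl) = ~-irrefl
        v,y-independent p q (inj₁ refl) (inj₂ refl) = v≁y
        v,y-independent p q (inj₂ refl) (inj₁ refl) = v≁y ∘ ~-sym
        v,y-independent p q (inj₂ refl) (inj₂ refl) = ~-irrefl

        Outer : Fin n → Fin n → Set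
        Outer t w = t ~ w × w ≢ v × w ≢ y

        neighbours-in-Nv : ∀ t w → v ~ t → Outer t w → ∀ z → t ~ z → z ≡ v ⊎ z ≡ y ⊎ z ≡ w
        neighbours-in-Nv t w v~t (t~w , w≢v , w≢y) =
          neighbours-among t v y w (~-sym v~t) (~-sym (Nv⊆Ny t v~t)) t~w (≢-sym y≢v) (≢-sym w≢v) (≢-sym w≢y)

        inner-neighbours : ∀ t w → v ~ t → Outer t w → ∀ z → t ~ z → z ≢ w → z ≡ v ⊎ z ≡ y
        inner-neighbours t w v~t Otw z t~z z≢w with neighbours-in-Nv t w v~t Otw z t~z
        ... | inj₁ z≡v         = inj₁ z≡v
        ... | inj₂ (inj₁ z≡y)  = inj₂ z≡y
        ... | inj₂ (inj₂ z≡w)  = ⊥-elim (z≢w z≡w)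

        outer-unique : ∀ t w w′ → v ~ t → Outer t w → Outer t w′ → w′ ≡ w
        outer-unique t w w′ v~t Otw (t~w′ , w′≢v , w′≢y) with neighbours-in-Nv t w v~t Otw w′ t~w′
        ... | inj₁ w′≡v        = ⊥-elim (w′≢v w′≡v)
        ... | inj₂ (inj₁ w′≡y) = ⊥-elim (w′≢y w′≡y)
        ... | inj₂ (inj₂ w′≡w) = w′≡w

        outer-not-on-triangle : ∀ t w q r → v ~ t → Outer t w → w ~ q → w ~ r → q ~ r → q ≢ t → r ≢ t → ⊥
        outer-not-on-triangle t w q r v~t Otw@(t~w , _) w~q w~r q~r q≢t r≢t with AdjToTriangle? w
        ... | yes (s , t₁ , t₂ , s~t₁ , t₁~t₂ , s~t₂ , _ , w≢t₁ , w≢t₂ , w~s)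
          with neighbours-among w t q r (~-sym t~w) w~q w~r (≢-sym q≢t) (≢-sym r≢t) (~⇒≢ q~r) s w~s
        ... | inj₁ refl = v,y-independent t₁ t₂
          (inner-neighbours t w v~t Otw t₁ s~t₁ (≢-sym w≢t₁))
          (inner-neighbours t w v~t Otw t₂ s~t₂ (≢-sym w≢t₂)) t₁~t₂
        ... | inj₂ (inj₁ refl) = pendant-edge-of-triangle-in-no-triangle
          q t₁ t₂ w r s~t₁ s~t₂ t₁~t₂ (~-sym w~q) w≢t₁ w≢t₂ q~r w~r
        ... | inj₂ (inj₂ refl) = pendant-edge-of-triangle-in-no-triangle
          r t₁ t₂ w q s~t₁ s~t₂ t₁~t₂ (~-sym w~r) w≢t₁ w≢t₂ (~-sym q~r) w~q
        outer-not-on-triangle t w q r v~t Otw@(t~w , _) w~q w~r q~r _ _ | no ¬tri-w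
          with ¬tri⇒twin w ¬tri-w
        ... | z , z≢w , _ , Nw⊆Nz with neighbours-in-Nv t w v~t Otw z (~-sym (Nw⊆Nz t (~-sym t~w)))
        ... | inj₁ refl        = Nv-independent q r (Nw⊆Nz q w~q) (Nw⊆Nz r w~r) q~r
        ... | inj₂ (inj₁ refl) = Ny-independent q r (Nw⊆Nz q w~q) (Nw⊆Nz r w~r) q~r
        ... | inj₂ (inj₂ z≡w)  = z≢w z≡w

        neighbour-hasFalseTwin : ∀ t w → v ~ t → Outer t w → HasFalseTwin t
        neighbour-hasFalseTwin t w v~t Otw with AdjToTriangle? t
        ... | no ¬tri-t = ¬tri⇒twin t ¬tri-t
        ... | yes (p , q , r , p~q , q~r , p~r , _ , t≢q , t≢r , t~p) with neighbours-in-Nv t w v~t Otw p t~p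
        ... | inj₁ refl        = ⊥-elim (Nv-independent q r p~q p~r q~r)
        ... | inj₂ (inj₁ refl) = ⊥-elim (Ny-independent q r p~q p~r q~r)
        ... | inj₂ (inj₂ refl) = ⊥-elim (outer-not-on-triangle t p q r v~t Otw p~q p~r q~r (≢-sym t≢q) (≢-sym t≢r))

        twin-partner : ∀ t w → v ~ t → Outer t w → ∃[ z ] (z ≢ t × v ~ z × Outer z w)
        twin-partner t w v~t Otw@(t~w , w≢v , w≢y) with neighbour-hasFalseTwin t w v~t Otw
        ... | z , z≢t , _ , Nt⊆Nz = z , z≢t , ~-sym (Nt⊆Nz v (~-sym v~t)) , Nt⊆Nz w t~w , w≢v , w≢y

        outer-shared : ∀ t u u′ w → v ~ t → v ~ u → v ~ u′ → Outer u w → Outer u′ w →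
                       (∀ z → v ~ z → z ≢ t → z ≡ u ⊎ z ≡ u′) → t ~ w
        outer-shared t u u′ w v~t v~u v~u′ Ouw Ou′w others with neighbour-avoiding t v y
        ... | t′ , Ott′ with twin-partner t t′ v~t Ott′
        ... | z , z≢t , v~z , Ozt′ with others z v~z z≢t
        ... | inj₁ refl = subst (t ~_) (outer-unique z w t′ v~u Ouw Ozt′) (proj₁ Ott′)
        ... | inj₂ refl = subst (t ~_) (outer-unique z w t′ v~u′ Ou′w Ozt′) (proj₁ Ott′)

        common-outer : ∃[ w ] (w ≢ v × w ≢ y × a ~ w × b ~ w × c ~ w)
        common-outer with neighbour-avoiding a v y
        ... | w , Oaw@(a~w , w≢v , w≢y) with twin-partner a w v~a Oaw
        ... | z , z≢a , v~z , Ozw with neighbours-of-v z v~z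
        ... | inj₁ z≡a         = ⊥-elim (z≢a z≡a)
        ... | inj₂ (inj₁ refl) = w , w≢v , w≢y , a~w , proj₁ Ozw , outer-shared c a b w v~c v~a v~b Oaw Ozw others
          where
          others : ∀ z → v ~ z → z ≢ c → z ≡ a ⊎ z ≡ b
          others z v~z z≢c with neighbours-of-v z v~z
          ... | inj₁ z≡a         = inj₁ z≡a
          ... | inj₂ (inj₁ z≡b)  = inj₂ z≡b
          ... | inj₂ (inj₂ z≡c)  = ⊥-elim (z≢c z≡c)
        ... | inj₂ (inj₂ refl) = w , w≢v , w≢y , a~w , outer-shared b a c w v~b v~a v~c Oaw Ozw others , proj₁ Ozw
          where
          others : ∀ z → v ~ z → z ≢ b → z ≡ a ⊎ z ≡ c
          others z v~z z≢b with neighbours-of-v z v~z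
          ... | inj₁ z≡a         = inj₁ z≡a
          ... | inj₂ (inj₁ z≡b)  = ⊥-elim (z≢b z≡b)
          ... | inj₂ (inj₂ z≡c)  = inj₂ z≡c

        order≤6 : Connected G → n ≤ 6
        order≤6 connected with common-outer
        ... | w , w≢v , w≢y , a~w , b~w , c~w = order≤length-of-closed connected {u = v} (here refl) closed
          where
          K₃,₃ : List (Fin n)
          K₃,₃ = v ∷ y ∷ w ∷ a ∷ b ∷ c ∷ []

          in-left : ∀ {z} → z ≡ v ⊎ z ≡ y ⊎ z ≡ w → z ∈ₗ K₃,₃
          in-left (inj₁ refl)        = here refl
          in-left (inj₂ (inj₁ refl)) = there (here refl)
          in-left (inj₂ (inj₂ refl)) = there (there (here refl))

          in-right : ∀ {z} → z ≡ a ⊎ z ≡ b ⊎ z ≡ c → z ∈ₗ K₃,₃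
          in-right (inj₁ refl)        = there (there (there (here refl)))
          in-right (inj₂ (inj₁ refl)) = there (there (there (there (here refl))))
          in-right (inj₂ (inj₂ refl)) = there (there (there (there (there (here refl)))))

          closed : ∀ {x z} → x ∈ₗ K₃,₃ → x ~ z → z ∈ₗ K₃,₃
          closed {z = z} (here refl)                 v~z = in-right (neighbours-of-v z v~z)
          closed {z = z} (there (here refl))         y~z = in-right (neighbours-of-y z y~z)
          closed {z = z} (there (there (here refl))) w~z =
            in-right (neighbours-among w a b c (~-sym a~w) (~-sym b~w) (~-sym c~w) a≢b a≢c b≢c z w~z)
          closed {z = z} (there (there (there (here refl))))         a~z =
            in-left (neighbours-in-Nv a w v~a (a~w , w≢v , w≢y) z a~z)
          closed {z = z} (there (there (there (there (here refl)))))  b~z =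
            in-left (neighbours-in-Nv b w v~b (b~w , w≢v , w≢y) z b~z)
          closed {z = z} (there (there (there (there (there (here refl)))))) c~z =
            in-left (neighbours-in-Nv c w v~c (c~w , w≢v , w≢y) z c~z)

      ¬adjToTriangle⇒order≤6 : (∀ u → ¬ AdjToTriangle G u → HasFalseTwin u) → Connected G →
                               ∀ v → ¬ AdjToTriangle G v → n ≤ 6
      ¬adjToTriangle⇒order≤6 ¬tri⇒twin connected v ¬tri-v with ¬tri⇒twin v ¬tri-v | three-neighbours v
      ... | y , y≢v , v≁y , Nv⊆Ny | a , b , c , v~a , v~b , v~c , a≢b , a≢c , b≢c =
        FalseTwinNeighbourhood.order≤6 ¬tri⇒twin v ¬tri-v y y≢v v≁y Nv⊆Ny a b c v~a v~b v~c a≢b a≢c b≢c connected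

      SICNumber≡n⇒allAdjToTriangle : 8 ≤ n → Connected G → SICNumberIs G n → ∀ v → AdjToTriangle G v
      SICNumber≡n⇒allAdjToTriangle 8≤n connected SIC≡n v with AdjToTriangle? v
      ... | yes tri-v = tri-v
      ... | no ¬tri-v = ⊥-elim (8≰6 (≤-trans 8≤n
              (¬adjToTriangle⇒order≤6 (¬adjToTriangle⇒hasFalseTwin SIC≡n) connected v ¬tri-v)))
        where
        8≰6 : ¬ 8 ≤ 6
        8≰6 (s≤s (s≤s (s≤s (s≤s (s≤s (s≤s ()))))))

mainTheorem9 : (n : ℕ) → 8 ≤ n → (G : Graph n) → Connected G → Cubic G → HasSIC G →
    (SICNumberIs G n ⇔ (∀ (v : Fin n) → AdjToTriangle G v))
mainTheorem9 n 8≤n G connected cubic (S , S-SIC) =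
  mk⇔ (SICNumber≡n⇒allAdjToTriangle V-SIC 8≤n connected) (allAdjToTriangle⇒SICNumber≡n V-SIC)
  where
  open CubicGraph G cubic
  V-SIC : IsSIC G ⊤
  V-SIC = IsSIC-mono G (λ _ → ∈⊤) S-SIC
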